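{- Let $\mathbf A$ be a WHB-algebra with dual space $(X(\mathbf A),\tau_{\mathbf A},\subseteq,R_{\mathbf A},S_{\mathbf A})$. Let $DC(X(\mathbf A))$ be the set of subsets $Y\subseteq X(\mathbf A)$ that are $\tau_{\mathbf A}$-closed and such that $P\in Y$ implies $R_{\mathbf A}(P)\subseteq Y$ and $S_{\mathbf A}(P)\subseteq Y$. Then the map $\Theta\colon DC(X(\mathbf A))\to\mathrm{Con}(\mathbf A)$, $\Theta(Y)=\{(a,b)\in A\times A:\sigma_{\mathbf A}(a)\cap Y=\sigma_{\mathbf A}(b)\cap Y\}$, is a bijection with inverse $\theta\mapsto\{P\in X(\mathbf A):\theta\text{ is compatible with }P\}$, and it is an order-reversing lattice isomorphism (i.e., $\mathrm{Con}(\mathbf A)$ is isomorphic to $DC(X(\mathbf A))$ ordered by reverse inclusion).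
   Context: A WHB-algebra is an algebra $(A,\wedge,\vee,\to,\leftarrow,0,1)$ such that $(A,\wedge,\vee,0,1)$ is a bounded distributive lattice and for all $a,b,c\in A$: $a\to a=1$; $a\to(b\wedge c)=(a\to b)\wedge(a\to c)$; $(a\vee b)\to c=(a\to c)\wedge(b\to c)$; $(a\to b)\wedge(b\to c)\le a\to c$; $a\leftarrow a=0$; $(a\vee b)\leftarrow c=(a\leftarrow c)\vee(b\leftarrow c)$; $a\leftarrow(b\wedge c)=(a\leftarrow b)\vee(a\leftarrow c)$; $a\leftarrow c\le(a\leftarrow b)\vee(b\leftarrow c)$; $a\wedge((a\to b)\leftarrow 0)\le b$; $a\le b\vee(1\to(a\leftarrow b))$. $X(\mathbf A)$ is the set of prime filters, $\sigma_{\mathbf A}(a)=\{P\in X(\mathbf A):a\in P\}$, $\tau_{\mathbf A}$ is the topology with subbase $\{\sigma_{\mathbf A}(a)\}\cup\{X(\mathbf A)\setminus\sigma_{\mathbf A}(a)\}$. $(P,Q)\in R_{\mathbf A}$ iff for all $a,b$: $a\to b\in P$, $a\in Q$ imply $b\in Q$; $(P,Q)\in S_{\mathbf A}$ iff for all $a,b$: $a\in Q$, $b\notin Q$ imply $a\leftarrow b\in P$; $R(P)=\{Q:(P,Q)\in R\}$. A congruence $\theta$ is compatible with $P$ if $(a,b)\in\theta$ and $a\in P$ imply $b\in P$. -}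

module Defs where

open import Level using (Level; suc; _⊔_)
open import Data.Product using (Σ; _×_; _,_)
open import Data.Sum using (_⊎_)
open import Data.List using (List)
open import Data.List.Relation.Unary.All using (All)
open import Relation.Nullary using (¬_)
open import Relation.Binary using (Rel; IsEquivalence)
open import Relation.Binary.PropositionalEquality using (_≡_)
open import Algebra.Lattice.Structures using (IsDistributiveLattice)
open import Algebra.Lattice.Bundles using (DistributiveLattice)

infix 2 _⇔_
_⇔_ : ∀ {p q} → Set p → Set q → Set (p ⊔ q)
A ⇔ B = (A → B) × (B → A)

-- WHB-algebras.  The implication  a → b  is written  a ⇒ b  and the
-- co-implication  a ← b  is written  a ⇐ b  (since → is reserved in Agda).

record WHB (a : Level) : Set (suc a) where
  infixr 7 _∧_
  infixr 6 _∨_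
  infixr 5 _⇒_ _⇐_
  infix 4 _≤_
  field
    Carrier : Set a
    _∧_ _∨_ _⇒_ _⇐_ : Carrier → Carrier → Carrier
    𝟘 𝟙 : Carrier
    isDistributiveLattice : IsDistributiveLattice _≡_ _∨_ _∧_
    𝟘-least : ∀ x → 𝟘 ∧ x ≡ 𝟘
    𝟙-greatest : ∀ x → x ∧ 𝟙 ≡ x

  _≤_ : Carrier → Carrier → Set a
  x ≤ y = x ∧ y ≡ x

  field
    ⇒-refl : ∀ x → (x ⇒ x) ≡ 𝟙
    ⇒-∧ : ∀ x y z → (x ⇒ (y ∧ z)) ≡ ((x ⇒ y) ∧ (x ⇒ z))
    ⇒-∨ : ∀ x y z → ((x ∨ y) ⇒ z) ≡ ((x ⇒ z) ∧ (y ⇒ z))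
    ⇒-trans : ∀ x y z → ((x ⇒ y) ∧ (y ⇒ z)) ≤ (x ⇒ z)
    ⇐-refl : ∀ x → (x ⇐ x) ≡ 𝟘
    ⇐-∨ : ∀ x y z → ((x ∨ y) ⇐ z) ≡ ((x ⇐ z) ∨ (y ⇐ z))
    ⇐-∧ : ∀ x y z → (x ⇐ (y ∧ z)) ≡ ((x ⇐ y) ∨ (x ⇐ z))
    ⇐-trans : ∀ x y z → (x ⇐ z) ≤ ((x ⇐ y) ∨ (y ⇐ z))
    mix₁ : ∀ x y → (x ∧ ((x ⇒ y) ⇐ 𝟘)) ≤ y
    mix₂ : ∀ x y → x ≤ (y ∨ (𝟙 ⇒ (x ⇐ y)))

module _ {a : Level} (A : WHB a) where
  open WHB A

  record PrimeFilter : Set (suc a) where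
    field
      ∈P : Carrier → Set a
      𝟙∈ : ∈P 𝟙
      𝟘∉ : ¬ ∈P 𝟘
      up : ∀ x y → x ≤ y → ∈P x → ∈P y
      meet : ∀ x y → ∈P x → ∈P y → ∈P (x ∧ y)
      prime : ∀ x y → ∈P (x ∨ y) → ∈P x ⊎ ∈P y
  open PrimeFilter public

  X : Set (suc a)
  X = PrimeFilter

  Subset : Set (suc (suc a))
  Subset = X → Set (suc a)

  σ : Carrier → X → Set a
  σ x P = ∈P P x

  -- basic open sets: finite intersections of subbasic sets
  -- σ(x) (x ∈ pos) and X ∖ σ(y) (y ∈ neg)
  record Basic : Set a where
    constructor basic
    field
      pos neg : List Carrier

  _∈B_ : X → Basic → Set a
  P ∈B basic ps ns = All (λ x → σ x P) ps × All (λ y → ¬ σ y P) ns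

  -- Y is τ-closed: its complement is open, i.e. every point outside Y
  -- has a basic open neighbourhood disjoint from Y.
  Closed : Subset → Set (suc a)
  Closed Y = ∀ P → ¬ Y P → Σ Basic λ B → P ∈B B × (∀ Q → Q ∈B B → ¬ Y Q)

  R : X → X → Set a
  R P Q = ∀ x y → ∈P P (x ⇒ y) → ∈P Q x → ∈P Q y

  S : X → X → Set a
  S P Q = ∀ x y → ∈P Q x → ¬ ∈P Q y → ∈P P (x ⇐ y)

  record IsDC (Y : Subset) : Set (suc (suc a)) where
    field
      closed : Closed Y
      R-closed : ∀ P Q → Y P → R P Q → Y Q
      S-closed : ∀ P Q → Y P → S P Q → Y Q

  record DC : Set (suc (suc (suc a))) where
    field
      set : Subset
      isDC : IsDC set
  open DC public

  record IsCongruence (θ : Rel Carrier (suc a)) : Set (suc a) where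
    field
      isEquivalence : IsEquivalence θ
      ∧-cong : ∀ {x x′ y y′} → θ x x′ → θ y y′ → θ (x ∧ y) (x′ ∧ y′)
      ∨-cong : ∀ {x x′ y y′} → θ x x′ → θ y y′ → θ (x ∨ y) (x′ ∨ y′)
      ⇒-cong : ∀ {x x′ y y′} → θ x x′ → θ y y′ → θ (x ⇒ y) (x′ ⇒ y′)
      ⇐-cong : ∀ {x x′ y y′} → θ x x′ → θ y y′ → θ (x ⇐ y) (x′ ⇐ y′)

  record Congruence : Set (suc (suc a)) where
    field
      rel : Rel Carrier (suc a)
      isCongruence : IsCongruence rel
  open Congruence public

  ΘRel : Subset → Rel Carrier (suc a)
  ΘRel Y x y = ∀ P → Y P → (σ x P ⇔ σ y P)

  Compatible : Rel Carrier (suc a) → X → Set (suc a)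
  Compatible θ P = ∀ x y → θ x y → ∈P P x → ∈P P y

  Ψ : Congruence → Subset
  Ψ θ P = Compatible (rel θ) P

-- Classical principles (ambient ZFC of the paper), stated as hypotheses.

module _ {c ℓ : Level} (L : DistributiveLattice c ℓ) where
  open DistributiveLattice L

  record IsLPrimeFilter (F : Carrier → Set c) : Set (c ⊔ ℓ) where
    field
      up : ∀ x y → (x ∧ y) ≈ x → F x → F y
      meet : ∀ x y → F x → F y → F (x ∧ y)
      prime : ∀ x y → F (x ∨ y) → F x ⊎ F y

PrimeFilterTheorem : (c : Level) → Set (suc (suc c))
PrimeFilterTheorem c = (L : DistributiveLattice c (suc c)) →
  let open DistributiveLattice L in
  ∀ x y → ¬ ((x ∧ y) ≈ x) →
  Σ (Carrier → Set c) λ F → IsLPrimeFilter L F × F x × ¬ F y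

-- Both halves of the correspondence rest on one separation principle: if a
-- preorder ⊑ on A refines ≤ and keeps ∧ and ∨ as meets and joins, then
-- x ⋢ y is witnessed by a prime filter that is upward closed for ⊑ (the
-- prime filter theorem applied to the quotient lattice A/⊑).  Instantiated
-- with c ⊑ d ⇔ (c ⇒ d) ∈ P, resp. (c ⇐ d) ∉ P, it produces the R- and
-- S-successors of P needed to see that Θ(Y) respects ⇒ and ⇐; instantiated
-- with c ⊑ d ⇔ (c ∧ d) θ c it shows that θ is recovered from the prime
-- filters compatible with it.  That Y is recovered from Θ(Y) uses only that
-- Y is closed: a point outside Y is separated from Y by a basic open set
-- σ(⋀ ps) ∖ σ(⋁ ns).
module Submission where

open import Defs
open import Level using (Level; suc; Lift; lift; lower)
open import Data.Product using (Σ; _×_; _,_; proj₁; proj₂; swap)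
open import Data.Sum using (_⊎_; inj₁; inj₂; [_,_])
import Data.Sum as Sum
open import Data.List using (List; []; _∷_; foldr)
open import Data.List.Relation.Unary.All using (All; []; _∷_)
open import Function using (_∘_)
open import Relation.Nullary using (¬_)
open import Relation.Nullary.Decidable using (map′)
open import Relation.Binary using (Rel; IsEquivalence; Setoid)
import Relation.Binary.Reasoning.Setoid as SetoidReasoning
open import Relation.Binary.PropositionalEquality
  using (_≡_; refl; sym; cong; subst; module ≡-Reasoning)
open import Algebra.Lattice.Bundles using (Lattice; DistributiveLattice)
open import Algebra.Lattice.Structures using (IsDistributiveLattice)
import Algebra.Lattice.Properties.Lattice as LatticeProperties
import Relation.Binary.Lattice as OrderLattice
open import Axiom.ExcludedMiddle using (ExcludedMiddle)
open import Axiom.DoubleNegationElimination using (DoubleNegationElimination; em⇒dne)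

module _ {a : Level} (A : WHB a) where
  open WHB A
  open IsDistributiveLattice isDistributiveLattice
    using ( ∧-comm; ∧-assoc; ∨-comm; ∨-assoc; ∨-absorbs-∧; ∧-absorbs-∨
          ; ∨-distribˡ-∧; ∨-distribʳ-∧; ∧-distribˡ-∨; ∧-distribʳ-∨ )

  lattice : Lattice a a
  lattice = record { isLattice = IsDistributiveLattice.isLattice isDistributiveLattice }

  open LatticeProperties lattice using (∧-idem; ∨-∧-orderTheoreticLattice)
  private module Order = OrderLattice.Lattice ∨-∧-orderTheoreticLattice

  ≤-refl : ∀ x → x ≤ x
  ≤-refl = ∧-idem

  x∧y≤x : ∀ x y → x ∧ y ≤ x
  x∧y≤x x y = sym (Order.x∧y≤x x y)

  x∧y≤y : ∀ x y → x ∧ y ≤ y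
  x∧y≤y x y = sym (Order.x∧y≤y x y)

  x≤x∨y : ∀ x y → x ≤ x ∨ y
  x≤x∨y x y = sym (Order.x≤x∨y x y)

  y≤x∨y : ∀ x y → y ≤ x ∨ y
  y≤x∨y x y = sym (Order.y≤x∨y x y)

  ∨-identityˡ : ∀ x → 𝟘 ∨ x ≡ x
  ∨-identityˡ x = begin
    𝟘 ∨ x        ≡⟨ ∨-comm 𝟘 x ⟩
    x ∨ 𝟘        ≡⟨ cong (x ∨_) (sym (𝟘-least x)) ⟩
    x ∨ (𝟘 ∧ x)  ≡⟨ cong (x ∨_) (∧-comm 𝟘 x) ⟩
    x ∨ (x ∧ 𝟘)  ≡⟨ ∨-absorbs-∧ x 𝟘 ⟩
    x            ∎
    where open ≡-Reasoning

  ≤⇒⇒≡𝟙 : ∀ {x y} → x ≤ y → x ⇒ y ≡ 𝟙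
  ≤⇒⇒≡𝟙 {x} {y} x≤y = begin
    x ⇒ y              ≡⟨ sym (𝟙-greatest (x ⇒ y)) ⟩
    (x ⇒ y) ∧ 𝟙        ≡⟨ ∧-comm (x ⇒ y) 𝟙 ⟩
    𝟙 ∧ (x ⇒ y)        ≡⟨ cong (_∧ (x ⇒ y)) (sym (⇒-refl x)) ⟩
    (x ⇒ x) ∧ (x ⇒ y)  ≡⟨ sym (⇒-∧ x x y) ⟩
    x ⇒ (x ∧ y)        ≡⟨ cong (x ⇒_) x≤y ⟩
    x ⇒ x              ≡⟨ ⇒-refl x ⟩
    𝟙                  ∎
    where open ≡-Reasoning

  ≤⇒⇐≡𝟘 : ∀ {x y} → x ≤ y → x ⇐ y ≡ 𝟘
  ≤⇒⇐≡𝟘 {x} {y} x≤y = begin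
    x ⇐ y              ≡⟨ sym (∨-identityˡ (x ⇐ y)) ⟩
    𝟘 ∨ (x ⇐ y)        ≡⟨ cong (_∨ (x ⇐ y)) (sym (⇐-refl x)) ⟩
    (x ⇐ x) ∨ (x ⇐ y)  ≡⟨ sym (⇐-∧ x x y) ⟩
    x ⇐ (x ∧ y)        ≡⟨ cong (x ⇐_) x≤y ⟩
    x ⇐ x              ≡⟨ ⇐-refl x ⟩
    𝟘                  ∎
    where open ≡-Reasoning

  ⋀ : List Carrier → Carrier
  ⋀ = foldr _∧_ 𝟙

  ⋁ : List Carrier → Carrier
  ⋁ = foldr _∨_ 𝟘

  module _ (P : X A) where

    ∈-∧ : ∀ {x y} → ∈P P (x ∧ y) ⇔ (∈P P x × ∈P P y)
    ∈-∧ {x} {y} = (λ x∧y∈P → up P _ _ (x∧y≤x x y) x∧y∈P , up P _ _ (x∧y≤y x y) x∧y∈P)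
                , (λ (x∈P , y∈P) → meet P x y x∈P y∈P)

    ∈-∨ : ∀ {x y} → ∈P P (x ∨ y) ⇔ (∈P P x ⊎ ∈P P y)
    ∈-∨ {x} {y} = prime P x y , [ up P _ _ (x≤x∨y x y) , up P _ _ (y≤x∨y x y) ]

    ∈-⋀ : ∀ xs → All (λ x → ∈P P x) xs ⇔ ∈P P (⋀ xs)
    ∈-⋀ [] = (λ _ → 𝟙∈ P) , (λ _ → [])
    ∈-⋀ (x ∷ xs) =
        (λ { (x∈P ∷ xs⊆P) → proj₂ ∈-∧ (x∈P , proj₁ (∈-⋀ xs) xs⊆P) })
      , (λ ⋀∈P → let x∈P , ⋀xs∈P = proj₁ ∈-∧ ⋀∈P in x∈P ∷ proj₂ (∈-⋀ xs) ⋀xs∈P)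

    ∉-⋁ : ∀ xs → All (λ x → ¬ ∈P P x) xs ⇔ (¬ ∈P P (⋁ xs))
    ∉-⋁ [] = (λ _ → 𝟘∉ P) , (λ _ → [])
    ∉-⋁ (x ∷ xs) =
        (λ { (x∉P ∷ xs∉P) → [ x∉P , proj₁ (∉-⋁ xs) xs∉P ] ∘ proj₁ ∈-∨ })
      , (λ ⋁∉P → (⋁∉P ∘ proj₂ ∈-∨ ∘ inj₁) ∷ proj₂ (∉-⋁ xs) (⋁∉P ∘ proj₂ ∈-∨ ∘ inj₂))

  -- Valued in Set (suc a) because the prime filter theorem is stated for
  -- lattices with equality in Set (suc a); the quotient lattice below uses ⊑.
  record IsCompatiblePreorder (_⊑_ : Rel Carrier (suc a)) : Set (suc a) where
    field
      reflexive : ∀ {x y} → x ≤ y → x ⊑ y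
      ⊑-trans : ∀ {x y z} → x ⊑ y → y ⊑ z → x ⊑ z
      ∧-greatest : ∀ {x y z} → x ⊑ y → x ⊑ z → x ⊑ (y ∧ z)
      ∨-least : ∀ {x y z} → x ⊑ z → y ⊑ z → (x ∨ y) ⊑ z

    ∧-mono : ∀ {x y u v} → x ⊑ y → u ⊑ v → (x ∧ u) ⊑ (y ∧ v)
    ∧-mono x⊑y u⊑v = ∧-greatest (⊑-trans (reflexive (x∧y≤x _ _)) x⊑y)
                                (⊑-trans (reflexive (x∧y≤y _ _)) u⊑v)

    ∨-mono : ∀ {x y u v} → x ⊑ y → u ⊑ v → (x ∨ u) ⊑ (y ∨ v)
    ∨-mono x⊑y u⊑v = ∨-least (⊑-trans x⊑y (reflexive (x≤x∨y _ _)))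
                             (⊑-trans u⊑v (reflexive (y≤x∨y _ _)))

    _≋_ : Rel Carrier (suc a)
    x ≋ y = x ⊑ y × y ⊑ x

    ≡⇒≋ : ∀ {x y} → x ≡ y → x ≋ y
    ≡⇒≋ refl = reflexive (≤-refl _) , reflexive (≤-refl _)

    ∧≋⇒⊑ : ∀ {x y} → (x ∧ y) ≋ x → x ⊑ y
    ∧≋⇒⊑ (_ , x⊑x∧y) = ⊑-trans x⊑x∧y (reflexive (x∧y≤y _ _))

    ⊑⇒∧≋ : ∀ {x y} → x ⊑ y → (x ∧ y) ≋ x
    ⊑⇒∧≋ x⊑y = reflexive (x∧y≤x _ _) , ∧-greatest (reflexive (≤-refl _)) x⊑y

  module _ {_⊑_ : Rel Carrier (suc a)} (isPreorder : IsCompatiblePreorder _⊑_) where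
    open IsCompatiblePreorder isPreorder

    quotientLattice : DistributiveLattice a (suc a)
    quotientLattice = record
      { Carrier = Carrier ; _≈_ = _≋_ ; _∨_ = _∨_ ; _∧_ = _∧_
      ; isDistributiveLattice = record
        { isLattice = record
          { isEquivalence = record
            { refl = ≡⇒≋ refl
            ; sym = swap
            ; trans = λ (x⊑y , y⊑x) (y⊑z , z⊑y) → ⊑-trans x⊑y y⊑z , ⊑-trans z⊑y y⊑x }
          ; ∨-comm = λ x y → ≡⇒≋ (∨-comm x y)
          ; ∨-assoc = λ x y z → ≡⇒≋ (∨-assoc x y z)
          ; ∨-cong = λ (x⊑y , y⊑x) (u⊑v , v⊑u) → ∨-mono x⊑y u⊑v , ∨-mono y⊑x v⊑u
          ; ∧-comm = λ x y → ≡⇒≋ (∧-comm x y)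
          ; ∧-assoc = λ x y z → ≡⇒≋ (∧-assoc x y z)
          ; ∧-cong = λ (x⊑y , y⊑x) (u⊑v , v⊑u) → ∧-mono x⊑y u⊑v , ∧-mono y⊑x v⊑u
          ; absorptive = (λ x y → ≡⇒≋ (∨-absorbs-∧ x y)) , (λ x y → ≡⇒≋ (∧-absorbs-∨ x y))
          }
        ; ∨-distrib-∧ = (λ x y z → ≡⇒≋ (∨-distribˡ-∧ x y z)) , (λ x y z → ≡⇒≋ (∨-distribʳ-∧ x y z))
        ; ∧-distrib-∨ = (λ x y z → ≡⇒≋ (∧-distribˡ-∨ x y z)) , (λ x y z → ≡⇒≋ (∧-distribʳ-∨ x y z))
        }
      }

    module _ {F : Carrier → Set a} (isPrimeF : IsLPrimeFilter quotientLattice F) where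
      private module F = IsLPrimeFilter isPrimeF

      toPrimeFilter : ∀ {x y} → F x → ¬ F y → X A
      toPrimeFilter {x} {y} x∈F y∉F = record
        { ∈P = F
        ; 𝟙∈ = F.up x 𝟙 (≡⇒≋ (𝟙-greatest x)) x∈F
        ; 𝟘∉ = λ 𝟘∈F → y∉F (F.up 𝟘 y (≡⇒≋ (𝟘-least y)) 𝟘∈F)
        ; up = λ u v u≤v → F.up u v (≡⇒≋ u≤v)
        ; meet = F.meet
        ; prime = F.prime
        }

      toPrimeFilter-⊑-closed : ∀ x y → x ⊑ y → F x → F y
      toPrimeFilter-⊑-closed x y = F.up x y ∘ ⊑⇒∧≋

  module _ (Y : Subset A) where

    ΘRel-sym : ∀ {x y} → ΘRel A Y x y → ΘRel A Y y x
    ΘRel-sym x~y P P∈Y = swap (x~y P P∈Y)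

    ΘRel-isEquivalence : IsEquivalence (ΘRel A Y)
    ΘRel-isEquivalence = record
      { refl = λ _ _ → (λ x∈P → x∈P) , (λ x∈P → x∈P)
      ; sym = ΘRel-sym
      ; trans = λ x~y y~z P P∈Y → proj₁ (y~z P P∈Y) ∘ proj₁ (x~y P P∈Y)
                                , proj₂ (x~y P P∈Y) ∘ proj₂ (y~z P P∈Y)
      }

    ΘRel-Preserves : (Carrier → Carrier → Carrier) → Set (suc a)
    ΘRel-Preserves _∙_ = ∀ {x x′ y y′} → ΘRel A Y x x′ → ΘRel A Y y y′ →
      ∀ P → Y P → ∈P P (x ∙ y) → ∈P P (x′ ∙ y′)

    ΘRel-cong : ∀ {_∙_} → ΘRel-Preserves _∙_ → ∀ {x x′ y y′} →
      ΘRel A Y x x′ → ΘRel A Y y y′ → ΘRel A Y (x ∙ y) (x′ ∙ y′)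
    ΘRel-cong preserves x~x′ y~y′ P P∈Y =
      preserves x~x′ y~y′ P P∈Y , preserves (ΘRel-sym x~x′) (ΘRel-sym y~y′) P P∈Y

    ∈⇒ΘRel-compatible : ∀ P → Y P → Compatible A (ΘRel A Y) P
    ∈⇒ΘRel-compatible P P∈Y x y x~y = proj₁ (x~y P P∈Y)

    ΘRel-preserves-∧ : ΘRel-Preserves _∧_
    ΘRel-preserves-∧ x~x′ y~y′ P P∈Y x∧y∈P =
      let x∈P , y∈P = proj₁ (∈-∧ P) x∧y∈P
      in proj₂ (∈-∧ P) (proj₁ (x~x′ P P∈Y) x∈P , proj₁ (y~y′ P P∈Y) y∈P)

    ΘRel-preserves-∨ : ΘRel-Preserves _∨_
    ΘRel-preserves-∨ x~x′ y~y′ P P∈Y x∨y∈P =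
      proj₂ (∈-∨ P) (Sum.map (proj₁ (x~x′ P P∈Y)) (proj₁ (y~y′ P P∈Y)) (proj₁ (∈-∨ P) x∨y∈P))

  module _ (θ : Congruence A) where
    private
      _~_ = rel θ
      module θ = IsCongruence (isCongruence θ)
      module ~ = IsEquivalence θ.isEquivalence

    θ-setoid : Setoid a (suc a)
    θ-setoid = record { isEquivalence = θ.isEquivalence }

    ≡⇒θ : ∀ {x y} → x ≡ y → x ~ y
    ≡⇒θ refl = ~.refl

    Ψ-R-closed : ∀ P Q → Ψ A θ P → R A P Q → Ψ A θ Q
    Ψ-R-closed P Q P∈Ψ PRQ x y x~y x∈Q = PRQ x y x⇒y∈P x∈Q
      where
        open SetoidReasoning θ-setoid
        𝟙~x⇒y : 𝟙 ~ (x ⇒ y)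
        𝟙~x⇒y = begin
          𝟙      ≡⟨ sym (⇒-refl y) ⟩
          y ⇒ y  ≈⟨ θ.⇒-cong (~.sym x~y) ~.refl ⟩
          x ⇒ y  ∎
        x⇒y∈P : ∈P P (x ⇒ y)
        x⇒y∈P = P∈Ψ 𝟙 (x ⇒ y) 𝟙~x⇒y (𝟙∈ P)

    _⊑θ_ : Rel Carrier (suc a)
    x ⊑θ y = (x ∧ y) ~ x

    ⊑θ-isCompatiblePreorder : IsCompatiblePreorder _⊑θ_
    ⊑θ-isCompatiblePreorder = record
      { reflexive = ≡⇒θ
      ; ⊑-trans = λ {x} {y} {z} x⊑y y⊑z → begin
          x ∧ z        ≈⟨ θ.∧-cong (~.sym x⊑y) ~.refl ⟩
          (x ∧ y) ∧ z  ≡⟨ ∧-assoc x y z ⟩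
          x ∧ (y ∧ z)  ≈⟨ θ.∧-cong ~.refl y⊑z ⟩
          x ∧ y        ≈⟨ x⊑y ⟩
          x            ∎
      ; ∧-greatest = λ {x} {y} {z} x⊑y x⊑z → begin
          x ∧ (y ∧ z)  ≡⟨ ∧-assoc x y z ⟨
          (x ∧ y) ∧ z  ≈⟨ θ.∧-cong x⊑y ~.refl ⟩
          x ∧ z        ≈⟨ x⊑z ⟩
          x            ∎
      ; ∨-least = λ {x} {y} {z} x⊑z y⊑z → begin
          (x ∨ y) ∧ z        ≡⟨ ∧-distribʳ-∨ z x y ⟩
          (x ∧ z) ∨ (y ∧ z)  ≈⟨ θ.∨-cong x⊑z y⊑z ⟩
          x ∨ y              ∎
      }
      where open SetoidReasoning θ-setoid

    ⊑θ-compatible⇒Ψ : ∀ Q → Compatible A _⊑θ_ Q → Ψ A θ Q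
    ⊑θ-compatible⇒Ψ Q Q-up x y x~y = Q-up x y x⊑y
      where
        open SetoidReasoning θ-setoid
        x⊑y : x ⊑θ y
        x⊑y = begin
          x ∧ y  ≈⟨ θ.∧-cong ~.refl (~.sym x~y) ⟩
          x ∧ x  ≡⟨ ∧-idem x ⟩
          x      ∎

    θ⇒ΘRel-Ψ : ∀ {x y} → x ~ y → ΘRel A (Ψ A θ) x y
    θ⇒ΘRel-Ψ {x} {y} x~y P P∈Ψ = P∈Ψ x y x~y , P∈Ψ y x (~.sym x~y)

  module _ (P : X A) where

    ⇒∈-isCompatiblePreorder : IsCompatiblePreorder (λ x y → Lift (suc a) (∈P P (x ⇒ y)))
    ⇒∈-isCompatiblePreorder = record
      { reflexive = λ x≤y → lift (subst (∈P P) (sym (≤⇒⇒≡𝟙 x≤y)) (𝟙∈ P))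
      ; ⊑-trans = λ {x} {y} {z} (lift x⇒y∈P) (lift y⇒z∈P) →
          lift (up P _ _ (⇒-trans x y z) (meet P _ _ x⇒y∈P y⇒z∈P))
      ; ∧-greatest = λ {x} {y} {z} (lift x⇒y∈P) (lift x⇒z∈P) →
          lift (subst (∈P P) (sym (⇒-∧ x y z)) (meet P _ _ x⇒y∈P x⇒z∈P))
      ; ∨-least = λ {x} {y} {z} (lift x⇒z∈P) (lift y⇒z∈P) →
          lift (subst (∈P P) (sym (⇒-∨ x y z)) (meet P _ _ x⇒z∈P y⇒z∈P))
      }

    ⇐∉-isCompatiblePreorder : IsCompatiblePreorder (λ x y → Lift (suc a) (¬ ∈P P (x ⇐ y)))
    ⇐∉-isCompatiblePreorder = record
      { reflexive = λ x≤y → lift (𝟘∉ P ∘ subst (∈P P) (≤⇒⇐≡𝟘 x≤y))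
      ; ⊑-trans = λ {x} {y} {z} (lift x⇐y∉P) (lift y⇐z∉P) →
          lift ([ x⇐y∉P , y⇐z∉P ] ∘ proj₁ (∈-∨ P) ∘ up P _ _ (⇐-trans x y z))
      ; ∧-greatest = λ {x} {y} {z} (lift x⇐y∉P) (lift x⇐z∉P) →
          lift ([ x⇐y∉P , x⇐z∉P ] ∘ proj₁ (∈-∨ P) ∘ subst (∈P P) (⇐-∧ x y z))
      ; ∨-least = λ {x} {y} {z} (lift x⇐z∉P) (lift y⇐z∉P) →
          lift ([ x⇐z∉P , y⇐z∉P ] ∘ proj₁ (∈-∨ P) ∘ subst (∈P P) (⇐-∨ x y z))
      }

  module _ (pft : PrimeFilterTheorem a) where

    ⊑-separation : ∀ {_⊑_} → IsCompatiblePreorder _⊑_ → ∀ {x y} → ¬ x ⊑ y →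
      Σ (X A) λ Q → Compatible A _⊑_ Q × ∈P Q x × ¬ ∈P Q y
    ⊑-separation isPreorder {x} {y} x⋢y =
      let F , isPrimeF , x∈F , y∉F = pft (quotientLattice isPreorder) x y (x⋢y ∘ ∧≋⇒⊑)
      in  toPrimeFilter isPreorder isPrimeF x∈F y∉F
        , toPrimeFilter-⊑-closed isPreorder isPrimeF , x∈F , y∉F
      where open IsCompatiblePreorder isPreorder

    R-successor : ∀ P {x y} → ¬ ∈P P (x ⇒ y) →
      Σ (X A) λ Q → R A P Q × ∈P Q x × ¬ ∈P Q y
    R-successor P x⇒y∉P =
      let Q , Q-closed , x∈Q , y∉Q = ⊑-separation (⇒∈-isCompatiblePreorder P) (x⇒y∉P ∘ lower)
      in Q , (λ u v u⇒v∈P → Q-closed u v (lift u⇒v∈P)) , x∈Q , y∉Q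

  module _ (em : ExcludedMiddle (suc a)) where
    private
      dne : DoubleNegationElimination a
      dne = em⇒dne (map′ lower lift em)

      dne⁺ : DoubleNegationElimination (suc a)
      dne⁺ = em⇒dne em

    ¬Compatible⇒witness : ∀ (ρ : Rel Carrier (suc a)) P → ¬ Compatible A ρ P →
      Σ Carrier λ x → Σ Carrier λ y → ρ x y × ∈P P x × ¬ ∈P P y
    ¬Compatible⇒witness ρ P ¬compatible = dne⁺ λ noWitness →
      ¬compatible λ x y xρy x∈P → dne λ y∉P → noWitness (x , y , xρy , x∈P , y∉P)

    module _ (θ : Congruence A) where
      private
        module θ = IsCongruence (isCongruence θ)
        module ~ = IsEquivalence θ.isEquivalence

      Ψ-closed : Closed A (Ψ A θ)
      Ψ-closed P P∉Ψ =
        let x , y , x~y , x∈P , y∉P = ¬Compatible⇒witness (rel θ) P P∉Ψ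
        in  basic (x ∷ []) (y ∷ []) , (x∈P ∷ [] , y∉P ∷ [])
          , λ { Q (x∈Q ∷ [] , y∉Q ∷ []) Q∈Ψ → y∉Q (Q∈Ψ x y x~y x∈Q) }

      Ψ-S-closed : ∀ P Q → Ψ A θ P → S A P Q → Ψ A θ Q
      Ψ-S-closed P Q P∈Ψ PSQ x y x~y x∈Q = dne λ y∉Q →
        𝟘∉ P (P∈Ψ (x ⇐ y) 𝟘 x⇐y~𝟘 (PSQ x y x∈Q y∉Q))
        where
          open SetoidReasoning (θ-setoid θ)
          x⇐y~𝟘 : rel θ (x ⇐ y) 𝟘
          x⇐y~𝟘 = begin
            x ⇐ y  ≈⟨ θ.⇐-cong x~y ~.refl ⟩
            y ⇐ y  ≡⟨ ⇐-refl y ⟩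
            𝟘      ∎

      Ψ-isDC : IsDC A (Ψ A θ)
      Ψ-isDC = record
        { closed = Ψ-closed
        ; R-closed = Ψ-R-closed θ
        ; S-closed = Ψ-S-closed
        }

    Closed⇒separating-pair : ∀ {Y} → Closed A Y → ∀ P → ¬ Y P →
      Σ Carrier λ x → Σ Carrier λ y → ∈P P x × ¬ ∈P P y × (∀ Q → Y Q → ∈P Q x → ∈P Q y)
    Closed⇒separating-pair Y-closed P P∉Y
      with Y-closed P P∉Y
    ... | basic ps ns , (ps⊆P , ns∩P=∅) , B∩Y=∅ =
        ⋀ ps , ⋁ ns , proj₁ (∈-⋀ P ps) ps⊆P , proj₁ (∉-⋁ P ns) ns∩P=∅
      , λ Q Q∈Y ⋀ps∈Q → dne λ ⋁ns∉Q →
          B∩Y=∅ Q (proj₂ (∈-⋀ Q ps) ⋀ps∈Q , proj₂ (∉-⋁ Q ns) ⋁ns∉Q) Q∈Y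

    ΘRel-compatible⇔∈ : ∀ {Y} → Closed A Y → ∀ P → Compatible A (ΘRel A Y) P ⇔ Y P
    ΘRel-compatible⇔∈ {Y} Y-closed P = compatible⇒∈ , ∈⇒ΘRel-compatible Y P
      where
        compatible⇒∈ : Compatible A (ΘRel A Y) P → Y P
        compatible⇒∈ compatible = dne⁺ λ P∉Y →
          let x , y , x∈P , y∉P , separates = Closed⇒separating-pair Y-closed P P∉Y
              x~x∧y : ΘRel A Y x (x ∧ y)
              x~x∧y Q Q∈Y = (λ x∈Q → proj₂ (∈-∧ Q) (x∈Q , separates Q Q∈Y x∈Q))
                          , proj₁ ∘ proj₁ (∈-∧ Q)
          in y∉P (proj₂ (proj₁ (∈-∧ P) (compatible x (x ∧ y) x~x∧y x∈P)))

    ⊆⇔ΘRel-⊇ : ∀ {Y Z} → Closed A Z →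
      (∀ P → Y P → Z P) ⇔ (∀ x y → ΘRel A Z x y → ΘRel A Y x y)
    ⊆⇔ΘRel-⊇ {Y} {Z} Z-closed =
        (λ Y⊆Z x y x~y P P∈Y → x~y P (Y⊆Z P P∈Y))
      , (λ ΘZ⊆ΘY P P∈Y → proj₁ (ΘRel-compatible⇔∈ Z-closed P)
          λ x y x~y → ∈⇒ΘRel-compatible Y P P∈Y x y (ΘZ⊆ΘY x y x~y))

    module _ (pft : PrimeFilterTheorem a) where

      S-successor : ∀ P {x y} → ∈P P (x ⇐ y) →
        Σ (X A) λ Q → S A P Q × ∈P Q x × ¬ ∈P Q y
      S-successor P x⇐y∈P =
        let Q , Q-closed , x∈Q , y∉Q =
              ⊑-separation pft (⇐∉-isCompatiblePreorder P) (λ (lift x⇐y∉P) → x⇐y∉P x⇐y∈P)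
        in  Q , (λ u v u∈Q v∉Q → dne λ u⇐v∉P → v∉Q (Q-closed u v (lift u⇐v∉P) u∈Q))
          , x∈Q , y∉Q

      ΘRel-preserves-⇒ : ∀ {Y} → (∀ P Q → Y P → R A P Q → Y Q) → ΘRel-Preserves Y _⇒_
      ΘRel-preserves-⇒ R-closed {x} {x′} {y} {y′} x~x′ y~y′ P P∈Y x⇒y∈P = dne λ x′⇒y′∉P →
        let Q , PRQ , x′∈Q , y′∉Q = R-successor pft P x′⇒y′∉P
            Q∈Y = R-closed P Q P∈Y PRQ
        in y′∉Q (proj₁ (y~y′ Q Q∈Y) (PRQ x y x⇒y∈P (proj₂ (x~x′ Q Q∈Y) x′∈Q)))

      ΘRel-preserves-⇐ : ∀ {Y} → (∀ P Q → Y P → S A P Q → Y Q) → ΘRel-Preserves Y _⇐_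
      ΘRel-preserves-⇐ S-closed {x} {x′} {y} {y′} x~x′ y~y′ P P∈Y x⇐y∈P =
        let Q , PSQ , x∈Q , y∉Q = S-successor P x⇐y∈P
            Q∈Y = S-closed P Q P∈Y PSQ
        in PSQ x′ y′ (proj₁ (x~x′ Q Q∈Y) x∈Q) (y∉Q ∘ proj₂ (y~y′ Q Q∈Y))

      ΘRel-isCongruence : (Y : DC A) → IsCongruence A (ΘRel A (set Y))
      ΘRel-isCongruence Y = record
        { isEquivalence = ΘRel-isEquivalence (set Y)
        ; ∧-cong = ΘRel-cong (set Y) (ΘRel-preserves-∧ (set Y))
        ; ∨-cong = ΘRel-cong (set Y) (ΘRel-preserves-∨ (set Y))
        ; ⇒-cong = ΘRel-cong (set Y) (ΘRel-preserves-⇒ (IsDC.R-closed (isDC Y)))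
        ; ⇐-cong = ΘRel-cong (set Y) (ΘRel-preserves-⇐ (IsDC.S-closed (isDC Y)))
        }

      ΘRel-Ψ⇒θ : (θ : Congruence A) → ∀ {x y} → ΘRel A (Ψ A θ) x y → rel θ x y
      ΘRel-Ψ⇒θ θ {x} {y} x~y = begin
        x      ≈⟨ ΘRel-Ψ⇒⊑θ x~y ⟨
        x ∧ y  ≡⟨ ∧-comm x y ⟩
        y ∧ x  ≈⟨ ΘRel-Ψ⇒⊑θ (ΘRel-sym (Ψ A θ) x~y) ⟩
        y      ∎
        where
          open SetoidReasoning (θ-setoid θ)
          ΘRel-Ψ⇒⊑θ : ∀ {u v} → ΘRel A (Ψ A θ) u v → _⊑θ_ θ u v
          ΘRel-Ψ⇒⊑θ {u} {v} u~v = dne⁺ λ u⋢v →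
            let Q , Q-closed , u∈Q , v∉Q = ⊑-separation pft (⊑θ-isCompatiblePreorder θ) u⋢v
            in v∉Q (proj₁ (u~v Q (⊑θ-compatible⇒Ψ θ Q Q-closed)) u∈Q)

theorem5p10 : ∀ {a : Level} → ExcludedMiddle (suc a) → PrimeFilterTheorem a →
    (A : WHB a) →
    ((Y : DC A) → IsCongruence A (ΘRel A (set Y)))
    × ((θ : Congruence A) → IsDC A (Ψ A θ))
    × ((θ : Congruence A) → ∀ x y → (ΘRel A (Ψ A θ) x y ⇔ rel θ x y))
    × ((Y : DC A) → ∀ P →
        (Compatible A (ΘRel A (set Y)) P ⇔ set Y P))
    × ((Y Z : DC A) →
        ((∀ P → set Y P → set Z P) ⇔ (∀ x y → ΘRel A (set Z) x y → ΘRel A (set Y) x y)))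
theorem5p10 em pft A =
    ΘRel-isCongruence A em pft
  , Ψ-isDC A em
  , (λ θ x y → ΘRel-Ψ⇒θ A em pft θ , θ⇒ΘRel-Ψ A θ)
  , (λ Y → ΘRel-compatible⇔∈ A em (IsDC.closed (isDC Y)))
  , (λ Y Z → ⊆⇔ΘRel-⊇ A em (IsDC.closed (isDC Z)))
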